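{- Let $G$ be a digraph, $k$ a nonnegative integer, and $(S,T)$ a $k$-admissible pair of vertex sets of $G$ with $|V(G)\setminus(S\cup T)|\le k+1$. Then $G$ has a gapless $S$--$T$ chain of order at most $k$.
   Context: Digraphs are simple. For $v\in V(G)$, $N^+(v)$ ($N^-(v)$) is its set of out- (in-)neighbors, $N^\pm[v]=N^\pm(v)\cup\{v\}$; for $U\subseteq V(G)$, $N^\pm[U]=\bigcup_{v\in U}N^\pm[v]$, $N^\pm(U)=N^\pm[U]\setminus U$, $d^\pm(U)=|N^\pm(U)|$. A pair $(S,T)$ of vertex sets is $k$-admissible if $N^+[S]\cap T=\emptyset$, $d^+(S)\le k$ and $d^-(T)\le k$. A separation of $G$ is a pair $(A,B)$ with $A\cup B=V(G)$ and no edge from $A\setminus B$ to $B\setminus A$; its order is $|A\cap B|$. A separation chain is a sequence $((A_0,B_0),\dots,(A_r,B_r))$ of separations with $A_0\subseteq\dots\subseteq A_r$ and $B_r\subseteq\dots\subseteq B_0$; its order is the maximum order of its members; it is gapless if for every $0<i\le r$, $|A_i\setminus A_{i-1}|\le1$ or $|B_{i-1}\setminus B_i|\le1$; it is an $S$--$T$ chain (for disjoint $S,T$) if $B_0=V(G)\setminus S$ and $A_r=V(G)\setminus T$. -}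

module Defs where

open import Data.Nat using (ℕ; zero; suc; _≤_)
open import Data.Bool using (Bool; true; false; _∨_; _∧_)
open import Data.Fin using (Fin; zero; suc; inject₁; fromℕ)
open import Data.Fin.Subset using (Subset; _∈_; _∪_; _∩_; _─_; ∁; ⊤; ⊥; ∣_∣; _⊆_)
open import Data.Vec using (lookup; tabulate)
open import Data.Sum using (_⊎_)
open import Relation.Binary.PropositionalEquality using (_≡_)

record Digraph (n : ℕ) : Set where
  field
    adj      : Fin n → Fin n → Bool
    loopless : ∀ v → adj v v ≡ false
open Digraph public

anyFin : ∀ {n} → (Fin n → Bool) → Bool
anyFin {zero}  f = false
anyFin {suc n} f = f zero ∨ anyFin (λ i → f (suc i))

module _ {n : ℕ} (G : Digraph n) where

  N⁺[_] : Subset n → Subset n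
  N⁺[ U ] = tabulate λ w → lookup U w ∨ anyFin (λ v → lookup U v ∧ adj G v w)

  N⁻[_] : Subset n → Subset n
  N⁻[ U ] = tabulate λ w → lookup U w ∨ anyFin (λ v → lookup U v ∧ adj G w v)

  N⁺ N⁻ : Subset n → Subset n
  N⁺ U = N⁺[ U ] ─ U
  N⁻ U = N⁻[ U ] ─ U

  d⁺ d⁻ : Subset n → ℕ
  d⁺ U = ∣ N⁺ U ∣
  d⁻ U = ∣ N⁻ U ∣

  Admissible : ℕ → Subset n → Subset n → Set
  Admissible k S T = (N⁺[ S ] ∩ T ≡ ⊥) × (d⁺ S ≤ k) × (d⁻ T ≤ k)
    where open import Data.Product using (_×_)

  IsSeparation : Subset n → Subset n → Set
  IsSeparation A B =
    (A ∪ B ≡ ⊤) ×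
    (∀ u v → u ∈ A ─ B → v ∈ B ─ A → adj G u v ≡ false)
    where open import Data.Product using (_×_)

  order : Subset n → Subset n → ℕ
  order A B = ∣ A ∩ B ∣

  record SeparationChain : Set where
    field
      r      : ℕ
      A B    : Fin (suc r) → Subset n
      isSep  : ∀ i → IsSeparation (A i) (B i)
      A-mono : ∀ (i : Fin r) → A (inject₁ i) ⊆ A (suc i)
      B-anti : ∀ (i : Fin r) → B (suc i) ⊆ B (inject₁ i)

  open SeparationChain public

  ChainOrder≤ : SeparationChain → ℕ → Set
  ChainOrder≤ C k = ∀ i → order (A C i) (B C i) ≤ k

  Gapless : SeparationChain → Set
  Gapless C = ∀ (i : Fin (r C)) →
    (∣ A C (suc i) ─ A C (inject₁ i) ∣ ≤ 1) ⊎ (∣ B C (inject₁ i) ─ B C (suc i) ∣ ≤ 1)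

  IsSTChain : Subset n → Subset n → SeparationChain → Set
  IsSTChain S T C = (B C zero ≡ ∁ S) × (A C (fromℕ (r C)) ≡ ∁ T)
    where open import Data.Product using (_×_)

-- Let R be the set of vertices outside S ∪ T. As ∣R∣ ≤ k + 1 and d⁺(S) ≤ k, some
-- X ⊆ R with at most one element avoids N⁺[S] and leaves ∣R ∖ X∣ ≤ k: take X = ∅
-- if R ⊆ N⁺(S), and otherwise a single vertex of R ∖ N⁺(S). Choose Y likewise
-- for N⁻[T]. Then (V ∖ (T ∪ X), V ∖ S), (V ∖ T, V ∖ (S ∪ Y)) is an S–T chain:
-- its separators are contained in R ∖ X and R ∖ Y, and the step between the two
-- separations moves only the vertices of X to the A-side.
module Submission where

open import Defs
open import Data.Nat using (ℕ; _≤_; _+_; suc; z≤n; s≤s⁻¹)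
open import Data.Nat.Properties using (≤-trans; ≤-reflexive; +-comm)
open import Data.Fin using (Fin; zero; suc)
open import Data.Fin.Subset
  using (Subset; inside; outside; _∈_; _∉_; _⊆_; _∪_; _∩_; _─_; ∁; ⊤; ⊥; ⁅_⁆; ∣_∣)
open import Data.Fin.Subset.Properties
open import Data.Vec using (_∷_; there; lookup; tabulate)
open import Data.Vec.Properties using ([]=⇒lookup; lookup⇒[]=; lookup∘tabulate)
open import Data.Bool using (Bool; true; false; _∨_; _∧_)
open import Data.Bool.Properties using (∨-zeroʳ; ¬-not)
open import Data.Product using (Σ; ∃; _×_; _,_)
open import Data.Empty using (⊥-elim)
open import Data.Sum using (inj₁; inj₂; [_,_])
open import Function using (_∘_)
open import Relation.Nullary using (yes; no)
open import Relation.Binary.PropositionalEquality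
  using (_≡_; refl; sym; trans; cong; cong₂; subst)

private
  variable
    n : ℕ
    x : Fin n
    p q : Subset n

x∈p─q⇒x∉q : x ∈ p ─ q → x ∉ q
x∈p─q⇒x∉q {x = zero}  {_ ∷ _} {inside  ∷ _} ()
x∈p─q⇒x∉q {x = zero}  {_ ∷ _} {outside ∷ _} _ ()
x∈p─q⇒x∉q {x = suc x} {_ ∷ _} {_ ∷ _} (there x∈) x∈q = x∈p─q⇒x∉q x∈ (drop-there x∈q)

x∉p∪q : x ∉ p → x ∉ q → x ∉ p ∪ q
x∉p∪q {p = p} {q} x∉p x∉q = [ x∉p , x∉q ] ∘ x∈p∪q⁻ p q

∁p∪q⊆∁p : ∁ (p ∪ q) ⊆ ∁ p
∁p∪q⊆∁p {q = q} = p⊆q⇒∁p⊇∁q (p⊆p∪q q)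

∁p∪q⊆∁q : ∁ (p ∪ q) ⊆ ∁ q
∁p∪q⊆∁q {p = p} {q} = p⊆q⇒∁p⊇∁q (q⊆p∪q p q)

∁[q∪z]∩∁p⊆∁[p∪q]─z : ∀ (p q z : Subset n) → ∁ (q ∪ z) ∩ ∁ p ⊆ ∁ (p ∪ q) ─ z
∁[q∪z]∩∁p⊆∁[p∪q]─z p q z x∈ with x∈p∩q⁻ (∁ (q ∪ z)) (∁ p) x∈
... | x∈∁[q∪z] , x∈∁p =
  x∈p∧x∉q⇒x∈p─q (x∉p⇒x∈∁p (x∉p∪q (x∈∁p⇒x∉p x∈∁p) (x∈∁p⇒x∉p (∁p∪q⊆∁p x∈∁[q∪z]))))
                (x∈∁p⇒x∉p (∁p∪q⊆∁q x∈∁[q∪z]))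

∁q∩∁[p∪z]⊆∁[p∪q]─z : ∀ (p q z : Subset n) → ∁ q ∩ ∁ (p ∪ z) ⊆ ∁ (p ∪ q) ─ z
∁q∩∁[p∪z]⊆∁[p∪q]─z p q z x∈ with x∈p∩q⁻ (∁ q) (∁ (p ∪ z)) x∈
... | x∈∁q , x∈∁[p∪z] =
  x∈p∧x∉q⇒x∈p─q (x∉p⇒x∈∁p (x∉p∪q (x∈∁p⇒x∉p (∁p∪q⊆∁p x∈∁[p∪z])) (x∈∁p⇒x∉p x∈∁q)))
                (x∈∁p⇒x∉p (∁p∪q⊆∁q x∈∁[p∪z]))

∁q─∁[q∪z]⊆z : ∀ (q z : Subset n) → ∁ q ─ ∁ (q ∪ z) ⊆ z
∁q─∁[q∪z]⊆z q z x∈ with x∈p∪q⁻ q z (x∉∁p⇒x∈p (x∈p─q⇒x∉q x∈))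
... | inj₁ x∈q = ⊥-elim (x∈∁p⇒x∉p (p─q⊆p (∁ q) _ x∈) x∈q)
... | inj₂ x∈z = x∈z

∃-small-⊆-avoiding : ∀ {k} (R N : Subset n) → ∣ R ∣ ≤ suc k → ∣ N ∣ ≤ k →
                      ∃ λ X → X ⊆ R ─ N × ∣ X ∣ ≤ 1 × ∣ R ─ X ∣ ≤ k
∃-small-⊆-avoiding {n} R N ∣R∣≤1+k ∣N∣≤k with nonempty? (R ─ N)
... | yes (y , y∈R─N) =
  ⁅ y ⁆ , (λ x∈⁅y⁆ → subst (_∈ R ─ N) (sym (x∈⁅y⁆⇒x≡y y x∈⁅y⁆)) y∈R─N)
        , ≤-reflexive (∣⁅x⁆∣≡1 y)
        , s≤s⁻¹ (≤-trans (x∈p⇒∣p-x∣<∣p∣ (p─q⊆p R N y∈R─N)) ∣R∣≤1+k)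
... | no R─N-empty =
  ⊥ , ⊥⊆ , subst (_≤ 1) (sym (∣⊥∣≡0 n)) z≤n
    , subst (λ R′ → ∣ R′ ∣ ≤ _) (sym (p─⊥≡p R)) (≤-trans (p⊆q⇒∣p∣≤∣q∣ R⊆N) ∣N∣≤k)
  where
  R⊆N : R ⊆ N
  R⊆N {x} x∈R = x∉∁p⇒x∈p λ x∈∁N →
    R─N-empty (x , x∈p∧x∉q⇒x∈p─q x∈R (x∈∁p⇒x∉p x∈∁N))

∨-trueˡ : ∀ {a b} → a ≡ true → a ∨ b ≡ true
∨-trueˡ refl = refl

x∈tabulate : (f : Fin n → Bool) → f x ≡ true → x ∈ tabulate f
x∈tabulate {x = x} f fx = lookup⇒[]= x _ (trans (lookup∘tabulate f x) fx)

anyFin-true : (f : Fin n → Bool) (i : Fin n) → f i ≡ true → anyFin f ≡ true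
anyFin-true f zero    fi rewrite fi = refl
anyFin-true f (suc i) fi rewrite anyFin-true (f ∘ suc) i fi = ∨-zeroʳ (f zero)

module _ (G : Digraph n) where

  private
    variable
      u v : Fin n
      P Q U V : Subset n

  ∈N⁺[]⁺ : u ∈ U → adj G u v ≡ true → v ∈ N⁺[ G ] U
  ∈N⁺[]⁺ {u} {U} {v} u∈U uv = x∈tabulate _
    (trans (cong (lookup U v ∨_) (anyFin-true _ u (cong₂ _∧_ ([]=⇒lookup u∈U) uv)))
           (∨-zeroʳ (lookup U v)))

  ∈N⁻[]⁺ : v ∈ U → adj G u v ≡ true → u ∈ N⁻[ G ] U
  ∈N⁻[]⁺ {v} {U} {u} v∈U uv = x∈tabulate _
    (trans (cong (lookup U u ∨_) (anyFin-true _ v (cong₂ _∧_ ([]=⇒lookup v∈U) uv)))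
           (∨-zeroʳ (lookup U u)))

  ⊆N⁺[] : U ⊆ N⁺[ G ] U
  ⊆N⁺[] x∈U = x∈tabulate _ (∨-trueˡ ([]=⇒lookup x∈U))

  ⊆N⁻[] : U ⊆ N⁻[ G ] U
  ⊆N⁻[] x∈U = x∈tabulate _ (∨-trueˡ ([]=⇒lookup x∈U))

  ∉N⁺[]⇒¬adj : u ∈ U → v ∉ N⁺[ G ] U → adj G u v ≡ false
  ∉N⁺[]⇒¬adj u∈U v∉ = ¬-not (v∉ ∘ ∈N⁺[]⁺ u∈U)

  ∉N⁻[]⇒¬adj : v ∈ U → u ∉ N⁻[ G ] U → adj G u v ≡ false
  ∉N⁻[]⇒¬adj v∈U u∉ = ¬-not (u∉ ∘ ∈N⁻[]⁺ v∈U)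

  ∈∁[U∪V]─N⁺U⇒∉N⁺[U] : x ∈ ∁ (U ∪ V) ─ N⁺ G U → x ∉ N⁺[ G ] U
  ∈∁[U∪V]─N⁺U⇒∉N⁺[U] x∈ x∈N⁺[U] = x∈p─q⇒x∉q x∈
    (x∈p∧x∉q⇒x∈p─q x∈N⁺[U] (x∈∁p⇒x∉p (∁p∪q⊆∁p (p─q⊆p _ _ x∈))))

  ∈∁[V∪U]─N⁻U⇒∉N⁻[U] : x ∈ ∁ (V ∪ U) ─ N⁻ G U → x ∉ N⁻[ G ] U
  ∈∁[V∪U]─N⁻U⇒∉N⁻[U] x∈ x∈N⁻[U] = x∈p─q⇒x∉q x∈
    (x∈p∧x∉q⇒x∈p─q x∈N⁻[U] (x∈∁p⇒x∉p (∁p∪q⊆∁q (p─q⊆p _ _ x∈))))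

  ∁-isSeparation : (∀ {x} → x ∈ P → x ∉ Q) →
                   (∀ {u v} → u ∈ P → v ∈ Q → adj G u v ≡ false) →
                   IsSeparation G (∁ Q) (∁ P)
  ∁-isSeparation {P} {Q} P∩Q=∅ no-P→Q = ⊆-antisym ⊆⊤ ⊤⊆ , no-edge
    where
    ⊤⊆ : ⊤ ⊆ ∁ Q ∪ ∁ P
    ⊤⊆ {x} _ with x ∈? P
    ... | yes x∈P = x∈p∪q⁺ (inj₁ (x∉p⇒x∈∁p (P∩Q=∅ x∈P)))
    ... | no  x∉P = x∈p∪q⁺ (inj₂ (x∉p⇒x∈∁p x∉P))
    no-edge : ∀ u v → u ∈ ∁ Q ─ ∁ P → v ∈ ∁ P ─ ∁ Q → adj G u v ≡ false
    no-edge u v u∈ v∈ = no-P→Q (x∉∁p⇒x∈p (x∈p─q⇒x∉q u∈)) (x∉∁p⇒x∈p (x∈p─q⇒x∉q v∈))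

  twoStepChain : ∀ {k S T A₀ B₁} →
                 IsSeparation G A₀ (∁ S) → IsSeparation G (∁ T) B₁ →
                 A₀ ⊆ ∁ T → B₁ ⊆ ∁ S → ∣ ∁ T ─ A₀ ∣ ≤ 1 →
                 order G A₀ (∁ S) ≤ k → order G (∁ T) B₁ ≤ k →
                 Σ (SeparationChain G) λ C →
                   Gapless G C × IsSTChain G S T C × ChainOrder≤ G C k
  twoStepChain {S = S} {T} {A₀} {B₁} sep₀ sep₁ A₀⊆ B₁⊆ gap ord₀ ord₁ =
    chain , (λ { zero → inj₁ gap }) , (refl , refl) , λ { zero → ord₀ ; (suc zero) → ord₁ }
    where
    chain : SeparationChain G
    chain = record
      { r      = 1
      ; A      = λ { zero → A₀ ; (suc zero) → ∁ T }
      ; B      = λ { zero → ∁ S ; (suc zero) → B₁ }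
      ; isSep  = λ { zero → sep₀ ; (suc zero) → sep₁ }
      ; A-mono = λ { zero → A₀⊆ }
      ; B-anti = λ { zero → B₁⊆ }
      }

  module _ {S T : Subset n} (N⁺[S]∩T≡⊥ : N⁺[ G ] S ∩ T ≡ ⊥) where

    T⇒∉N⁺[S] : v ∈ T → v ∉ N⁺[ G ] S
    T⇒∉N⁺[S] v∈T v∈N⁺[S] = ∉⊥ (subst (_ ∈_) N⁺[S]∩T≡⊥ (x∈p∩q⁺ (v∈N⁺[S] , v∈T)))

    S⇒∉T : v ∈ S → v ∉ T
    S⇒∉T v∈S v∈T = T⇒∉N⁺[S] v∈T (⊆N⁺[] v∈S)

    ∁[T∪X]-isSeparation : ∀ {X} → (∀ {x} → x ∈ X → x ∉ N⁺[ G ] S) →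
                          IsSeparation G (∁ (T ∪ X)) (∁ S)
    ∁[T∪X]-isSeparation {X} X-avoids = ∁-isSeparation disjoint no-edge
      where
      outside-N⁺[S] : ∀ {v} → v ∈ T ∪ X → v ∉ N⁺[ G ] S
      outside-N⁺[S] {v} v∈ with x∈p∪q⁻ T X v∈
      ... | inj₁ v∈T = T⇒∉N⁺[S] v∈T
      ... | inj₂ v∈X = X-avoids v∈X
      disjoint : ∀ {x} → x ∈ S → x ∉ T ∪ X
      disjoint x∈S x∈T∪X = outside-N⁺[S] x∈T∪X (⊆N⁺[] x∈S)
      no-edge : ∀ {u v} → u ∈ S → v ∈ T ∪ X → adj G u v ≡ false
      no-edge u∈S v∈ = ∉N⁺[]⇒¬adj u∈S (outside-N⁺[S] v∈)

    ∁[S∪Y]-isSeparation : ∀ {Y} → (∀ {y} → y ∈ Y → y ∉ N⁻[ G ] T) →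
                          IsSeparation G (∁ T) (∁ (S ∪ Y))
    ∁[S∪Y]-isSeparation {Y} Y-avoids = ∁-isSeparation disjoint no-edge
      where
      disjoint : ∀ {x} → x ∈ S ∪ Y → x ∉ T
      disjoint {x} x∈ with x∈p∪q⁻ S Y x∈
      ... | inj₁ x∈S = S⇒∉T x∈S
      ... | inj₂ x∈Y = Y-avoids x∈Y ∘ ⊆N⁻[]
      no-edge : ∀ {u v} → u ∈ S ∪ Y → v ∈ T → adj G u v ≡ false
      no-edge {u} u∈ v∈T with x∈p∪q⁻ S Y u∈
      ... | inj₁ u∈S = ∉N⁺[]⇒¬adj u∈S (T⇒∉N⁺[S] v∈T)
      ... | inj₂ u∈Y = ∉N⁻[]⇒¬adj v∈T (Y-avoids u∈Y)

lemma2 : {n : ℕ} (G : Digraph n) (k : ℕ) (S T : Subset n) →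
         Admissible G k S T →
         ∣ ∁ (S ∪ T) ∣ ≤ k + 1 →
         Σ (SeparationChain G) (λ C →
           Gapless G C × IsSTChain G S T C × ChainOrder≤ G C k)
lemma2 G k S T (N⁺[S]∩T≡⊥ , d⁺S≤k , d⁻T≤k) ∣R∣≤k+1
  with ∃-small-⊆-avoiding (∁ (S ∪ T)) (N⁺ G S) ∣R∣≤1+k d⁺S≤k
     | ∃-small-⊆-avoiding (∁ (S ∪ T)) (N⁻ G T) ∣R∣≤1+k d⁻T≤k
  where
  ∣R∣≤1+k : ∣ ∁ (S ∪ T) ∣ ≤ suc k
  ∣R∣≤1+k = ≤-trans ∣R∣≤k+1 (≤-reflexive (+-comm k 1))
... | X , X⊆R─N⁺S , ∣X∣≤1 , ∣R─X∣≤k | Y , Y⊆R─N⁻T , _ , ∣R─Y∣≤k =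
  twoStepChain G
    (∁[T∪X]-isSeparation G N⁺[S]∩T≡⊥ λ x∈X → ∈∁[U∪V]─N⁺U⇒∉N⁺[U] G (X⊆R─N⁺S x∈X))
    (∁[S∪Y]-isSeparation G N⁺[S]∩T≡⊥ λ y∈Y → ∈∁[V∪U]─N⁻U⇒∉N⁻[U] G (Y⊆R─N⁻T y∈Y))
    ∁p∪q⊆∁p ∁p∪q⊆∁p
    (≤-trans (p⊆q⇒∣p∣≤∣q∣ (∁q─∁[q∪z]⊆z T X)) ∣X∣≤1)
    (≤-trans (p⊆q⇒∣p∣≤∣q∣ (∁[q∪z]∩∁p⊆∁[p∪q]─z S T X)) ∣R─X∣≤k)
    (≤-trans (p⊆q⇒∣p∣≤∣q∣ (∁q∩∁[p∪z]⊆∁[p∪q]─z S T Y)) ∣R─Y∣≤k)
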